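{- Let $G$ be an $n$-node directed unweighted graph, and let $S\subseteq V(G)$ be a set of $|S|=s$ nodes of weak diameter $h$, i.e., $\mathrm{dist}_G(x,y)\le h$ for all $x,y\in S$. Let $P\subseteq S\times V(G)$ be a set of $|P|=p$ demand pairs (with $t$ reachable from $x$ for each $(x,t)\in P$). Then there exists an exact distance preserver of $G,P$ with $O((nsph)^{1/2}+n)$ edges.
   Context: An exact distance preserver of $G,P$ is a subgraph $H$ of $G$ with $\mathrm{dist}_H(x,t)=\mathrm{dist}_G(x,t)$ for all $(x,t)\in P$. -}

module Defs where

open import Data.Nat using (ℕ; zero; suc; _+_; _*_; _≤_; _<_)
open import Data.Fin using (Fin)
open import Data.Fin.Subset using (Subset; _∈_)
open import Data.Bool using (Bool; true; false; if_then_else_)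
open import Data.List using (List; map; allFin)
open import Data.Nat.ListAction using (sum)
open import Data.Product using (Σ; ∃; _×_; _,_)
open import Relation.Nullary using (¬_)
open import Relation.Binary.PropositionalEquality using (_≡_)

Graph : ℕ → Set
Graph n = Fin n → Fin n → Bool

_⊆G_ : ∀ {n} → Graph n → Graph n → Set
H ⊆G G = ∀ x y → H x y ≡ true → G x y ≡ true

data Walk {n : ℕ} (E : Graph n) : Fin n → Fin n → ℕ → Set where
  [] : ∀ {x} → Walk E x x zero
  _∷_ : ∀ {x y z k} → E x y ≡ true → Walk E y z k → Walk E x z (suc k)

IsDist : ∀ {n} → Graph n → Fin n → Fin n → ℕ → Set
IsDist E x y d = Walk E x y d × (∀ k → k < d → ¬ Walk E x y k)

DistLe : ∀ {n} → Graph n → Fin n → Fin n → ℕ → Set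
DistLe E x y h = Σ ℕ λ k → k ≤ h × Walk E x y k

Reachable : ∀ {n} → Graph n → Fin n → Fin n → Set
Reachable E x y = ∃ λ k → Walk E x y k

count : ∀ {n} → (Fin n → Fin n → Bool) → ℕ
count {n} M = sum (map (λ i → sum (map (λ j → if M i j then 1 else 0) (allFin n))) (allFin n))

IsPreserver : ∀ {n} → Graph n → (Fin n → Fin n → Bool) → Graph n → Set
IsPreserver G P H =
  H ⊆G G × (∀ x t → P x t ≡ true → ∀ d → IsDist G x t d → IsDist H x t d)

-- For every source x take a BFS tree in which each vertex w is entered from its
-- least-indexed in-neighbour one step closer to x; H is the union of the tree paths of
-- the demand pairs, so it preserves their distances. If u < u′ are in-neighbours of w
-- in H, say u = parent_x(w) and u′ = parent_y(w), then u is not closer to y than w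
-- (or y's tree would enter w from u), so the H-edge (u, w) does not increase the
-- distance from y. Along the tree path from x to t that distance starts at most h, ends
-- at dist(y, t) ≥ dist(x, t) − h, and grows by at most one per edge, so at most 2h edges
-- of the path fail to increase it. Charging each pair of in-edges of w to such an
-- event, over all y ∈ S and all demand paths, gives Σ_w indeg(w)² ≤ |E(H)| + 4sph, and
-- Cauchy–Schwarz, |E(H)|² ≤ n Σ_w indeg(w)², turns this into |E(H)|² ≤ n² + 8nsph.

module Submission where

open import Defs
open import Data.Bool using (Bool; true; false; if_then_else_; _∨_)
import Data.Bool.Properties as Bool
open import Data.Empty using (⊥-elim)
open import Data.Fin using (Fin; zero; suc; toℕ)
import Data.Fin.Properties as Fin
open import Data.Fin.Subset using (Subset; _∈_; ∣_∣; inside; outside)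
open import Data.Fin.Subset.Properties using (_∈?_)
open import Data.Vec using () renaming ([] to []ᵥ; _∷_ to _∷ᵥ_)
open import Data.List using (List; []; _∷_; map; tabulate)
import Data.List.Membership.DecPropositional as Membership
open import Data.List.Membership.Propositional using () renaming (_∈_ to _∈ₗ_)
open import Data.List.Relation.Unary.Any using (here; there)
open import Data.Maybe using (Maybe; just; nothing; fromMaybe)
import Data.Maybe as Maybe
open import Data.Nat using (ℕ; zero; suc; _+_; _*_; _≤_; _<_; z≤n; s≤s; _≤?_; _<?_)
import Data.Nat.ListAction as List
open import Data.Nat.Properties
open import Algebra.Properties.CommutativeSemigroup +-commutativeSemigroup using (xy∙z≈y∙xz)
open import Data.Nat.Tactic.RingSolver using (solve-∀; solve)
open import Data.Product using (Σ; ∃; ∃₂; _×_; _,_; proj₁; proj₂)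
open import Data.Sum using ([_,_]′)
open import Data.Vec.Functional using (Vector)
open import Function using (_∘_)
open import Relation.Binary using (tri<; tri≈; tri>)
open import Relation.Binary.PropositionalEquality
open import Relation.Nullary using (Dec; yes; no; does)
open import Relation.Nullary.Decidable using (_×-dec_; dec-true)
open import Relation.Unary using (Pred; Decidable)
open import Algebra.Properties.Semiring.Sum +-*-semiring
  using (sum; sum-syntax; sum-cong-≗; sum-replicate-zero; ∑-distrib-+; ∑-comm; *-distribˡ-sum; *-distribʳ-sum)

𝟙 : Bool → ℕ
𝟙 b = if b then 1 else 0

⟦_⟧ : ∀ {a} {A : Set a} → Dec A → ℕ
⟦ a? ⟧ = 𝟙 (does a?)

does≡true⇒ : ∀ {a} {A : Set a} (a? : Dec A) → does a? ≡ true → A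
does≡true⇒ (yes a) _ = a

1≤𝟙 : ∀ {b} → b ≡ true → 1 ≤ 𝟙 b
1≤𝟙 refl = ≤-refl

1≤⟦⟧ : ∀ {a} {A : Set a} (a? : Dec A) → A → 1 ≤ ⟦ a? ⟧
1≤⟦⟧ a? a = 1≤𝟙 (dec-true a? a)

m≤⟦⟧*m : ∀ {a} {A : Set a} (a? : Dec A) → A → ∀ {m} → m ≤ ⟦ a? ⟧ * m
m≤⟦⟧*m a? a {m} = subst (_≤ ⟦ a? ⟧ * m) (*-identityˡ m) (*-monoˡ-≤ m (1≤⟦⟧ a? a))

𝟙*𝟙 : ∀ b → 𝟙 b * 𝟙 b ≡ 𝟙 b
𝟙*𝟙 true  = refl
𝟙*𝟙 false = refl

𝟙-∨ : ∀ a b c → 𝟙 (a ∨ b) * c ≤ 𝟙 a * c + 𝟙 b * c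
𝟙-∨ true  b c = m≤m+n _ _
𝟙-∨ false b c = ≤-refl

𝟙*-monoʳ-≤ : ∀ b {m m′} → (b ≡ true → m ≤ m′) → 𝟙 b * m ≤ 𝟙 b * m′
𝟙*-monoʳ-≤ true  m≤m′ = *-monoʳ-≤ 1 (m≤m′ refl)
𝟙*-monoʳ-≤ false _    = z≤n

⟦⟧*-monoʳ-≤ : ∀ {a} {A : Set a} (a? : Dec A) {m m′} → (A → m ≤ m′) → ⟦ a? ⟧ * m ≤ ⟦ a? ⟧ * m′
⟦⟧*-monoʳ-≤ (yes a) m≤m′ = *-monoʳ-≤ 1 (m≤m′ a)
⟦⟧*-monoʳ-≤ (no  _) _    = z≤n

⟦⟧*𝟙*𝟙≤ : ∀ {a} {A : Set a} (a? : Dec A) b c {r} → (A → b ≡ true → c ≡ true → 1 ≤ r) →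
          ⟦ a? ⟧ * (𝟙 b * 𝟙 c) ≤ r
⟦⟧*𝟙*𝟙≤ (yes a) true  true  pos = pos a refl refl
⟦⟧*𝟙*𝟙≤ (yes _) true  false _   = z≤n
⟦⟧*𝟙*𝟙≤ (yes _) false _     _   = z≤n
⟦⟧*𝟙*𝟙≤ (no  _) _     _     _   = z≤n

⟦≤⟧+-≤ : ∀ {a b} (a≤?b : Dec (a ≤ b)) → a ≤ suc b → ⟦ a≤?b ⟧ + a ≤ suc b
⟦≤⟧+-≤ (yes a≤b) _     = s≤s a≤b
⟦≤⟧+-≤ (no  _)   a≤1+b = a≤1+b

∑-mono-≤ : ∀ {n} {f g : Vector ℕ n} → (∀ i → f i ≤ g i) → sum f ≤ sum g
∑-mono-≤ {zero}  f≤g = z≤n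
∑-mono-≤ {suc n} f≤g = +-mono-≤ (f≤g zero) (∑-mono-≤ (f≤g ∘ suc))

term≤sum : ∀ {n} (f : Vector ℕ n) i → f i ≤ sum f
term≤sum f zero    = m≤m+n _ _
term≤sum f (suc i) = ≤-trans (term≤sum (f ∘ suc) i) (m≤n+m _ _)

∑-const : ∀ n c → ∑[ i < n ] c ≡ n * c
∑-const zero    c = refl
∑-const (suc n) c = cong (c +_) (∑-const n c)

sum-*-sum : ∀ {n} (f g : Vector ℕ n) → sum f * sum g ≡ ∑[ i < n ] ∑[ j < n ] (f i * g j)
sum-*-sum f g = trans (*-distribʳ-sum (sum g) f) (sum-cong-≗ λ i → *-distribˡ-sum (f i) g)

∑-select : ∀ {n} (i : Fin n) (f : Vector ℕ n) → ∑[ j < n ] (⟦ j Fin.≟ i ⟧ * f j) ≡ f i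
∑-select {suc n} zero    f =
  trans (cong (f zero + 0 +_) (sum-replicate-zero n)) (trans (+-identityʳ _) (+-identityʳ _))
∑-select {suc n} (suc i) f = ∑-select i (f ∘ suc)

∑-fibres : ∀ {m n} (p : Fin m → Fin n) (f : Vector ℕ m) →
           ∑[ u < n ] ∑[ x < m ] (⟦ u Fin.≟ p x ⟧ * f x) ≡ sum f
∑-fibres p f =
  trans (∑-comm (λ u x → ⟦ u Fin.≟ p x ⟧ * f x)) (sum-cong-≗ λ x → ∑-select (p x) (λ _ → f x))

∑-fibres₂ : ∀ {m m′ n} (p : Fin m → Fin n) (q : Fin m′ → Fin n) (F : Fin m → Fin m′ → ℕ) →
            ∑[ u < n ] ∑[ u′ < n ] ∑[ x < m ] (⟦ u Fin.≟ p x ⟧ * ∑[ y < m′ ] (⟦ u′ Fin.≟ q y ⟧ * F x y))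
            ≡ ∑[ x < m ] ∑[ y < m′ ] F x y
∑-fibres₂ {m} {m′} {n} p q F = begin
  ∑[ u < n ] ∑[ u′ < n ] ∑[ x < m ] (⟦ u Fin.≟ p x ⟧ * G x u′)
    ≡⟨ sum-cong-≗ (λ u → ∑-comm (λ u′ x → ⟦ u Fin.≟ p x ⟧ * G x u′)) ⟩
  ∑[ u < n ] ∑[ x < m ] ∑[ u′ < n ] (⟦ u Fin.≟ p x ⟧ * G x u′)
    ≡⟨ sum-cong-≗ (λ u → sum-cong-≗ λ x → *-distribˡ-sum ⟦ u Fin.≟ p x ⟧ (G x)) ⟨
  ∑[ u < n ] ∑[ x < m ] (⟦ u Fin.≟ p x ⟧ * ∑[ u′ < n ] G x u′)
    ≡⟨ sum-cong-≗ (λ u → sum-cong-≗ λ x → cong (⟦ u Fin.≟ p x ⟧ *_) (∑-fibres q (F x))) ⟩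
  ∑[ u < n ] ∑[ x < m ] (⟦ u Fin.≟ p x ⟧ * ∑[ y < m′ ] F x y)
    ≡⟨ ∑-fibres p (λ x → ∑[ y < m′ ] F x y) ⟩
  ∑[ x < m ] ∑[ y < m′ ] F x y ∎
  where
  open ≡-Reasoning
  G : Fin m → Fin n → ℕ
  G x u′ = ∑[ y < m′ ] (⟦ u′ Fin.≟ q y ⟧ * F x y)

infix 4 _∈ₗ?_
_∈ₗ?_ : ∀ {n} (w : Fin n) (xs : List (Fin n)) → Dec (w ∈ₗ xs)
_∈ₗ?_ = Membership._∈?_ Fin._≟_

∑-∈-≤ : ∀ {n} (xs : List (Fin n)) (f : Vector ℕ n) →
        ∑[ w < n ] (⟦ w ∈ₗ? xs ⟧ * f w) ≤ List.sum (map f xs)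
∑-∈-≤ {n} []       f = ≤-reflexive (sum-replicate-zero n)
∑-∈-≤ {n} (x ∷ xs) f = begin
  ∑[ w < n ] (⟦ w ∈ₗ? x ∷ xs ⟧ * f w)
    ≤⟨ ∑-mono-≤ (λ w → 𝟙-∨ (does (w Fin.≟ x)) _ (f w)) ⟩
  ∑[ w < n ] (⟦ w Fin.≟ x ⟧ * f w + ⟦ w ∈ₗ? xs ⟧ * f w)
    ≡⟨ ∑-distrib-+ (λ w → ⟦ w Fin.≟ x ⟧ * f w) _ ⟩
  ∑[ w < n ] (⟦ w Fin.≟ x ⟧ * f w) + ∑[ w < n ] (⟦ w ∈ₗ? xs ⟧ * f w)
    ≤⟨ +-mono-≤ (≤-reflexive (∑-select x f)) (∑-∈-≤ xs f) ⟩
  f x + List.sum (map f xs) ∎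
  where open ≤-Reasoning

sum-map-tabulate : ∀ {a} {A : Set a} {n} (f : A → ℕ) (g : Fin n → A) →
                   List.sum (map f (tabulate g)) ≡ sum (f ∘ g)
sum-map-tabulate {n = zero}  f g = refl
sum-map-tabulate {n = suc n} f g = cong (f (g zero) +_) (sum-map-tabulate f (g ∘ suc))

count-∑ : ∀ {n} (M : Fin n → Fin n → Bool) → count M ≡ ∑[ i < n ] ∑[ j < n ] 𝟙 (M i j)
count-∑ {n} M =
  trans (sum-map-tabulate {n = n} _ (λ i → i)) (sum-cong-≗ {n} λ i → sum-map-tabulate {n = n} _ (λ j → j))

∣S∣≡∑ : ∀ {n} (S : Subset n) → ∣ S ∣ ≡ ∑[ y < n ] ⟦ y ∈? S ⟧
∣S∣≡∑ []ᵥ             = refl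
∣S∣≡∑ (inside  ∷ᵥ S) = cong suc (∣S∣≡∑ S)
∣S∣≡∑ (outside ∷ᵥ S) = ∣S∣≡∑ S

2ab≤a²+b² : ∀ a b → 2 * (a * b) ≤ a * a + b * b
2ab≤a²+b² a b = [ ordered , flipped ]′ (≤-total a b)
  where
  expand : ∀ a c → 2 * (a * (a + c)) + c * c ≡ a * a + (a + c) * (a + c)
  expand = solve-∀
  ordered : ∀ {a b} → a ≤ b → 2 * (a * b) ≤ a * a + b * b
  ordered {a} a≤b with m≤n⇒∃[o]m+o≡n a≤b
  ... | c , refl = ≤-trans (m≤m+n _ (c * c)) (≤-reflexive (expand a c))
  flipped : b ≤ a → 2 * (a * b) ≤ a * a + b * b
  flipped b≤a = subst₂ _≤_ (cong (2 *_) (*-comm b a)) (+-comm (b * b) (a * a)) (ordered b≤a)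

cauchy-schwarz : ∀ {n} (f : Vector ℕ n) → sum f * sum f ≤ n * ∑[ i < n ] (f i * f i)
cauchy-schwarz {n} f = *-cancelˡ-≤ 2 (begin
  2 * (sum f * sum f)                            ≡⟨ cong (2 *_) (sum-*-sum f f) ⟩
  2 * ∑[ i < n ] ∑[ j < n ] (f i * f j)          ≡⟨ *-distribˡ-sum {n} 2 _ ⟩
  ∑[ i < n ] (2 * ∑[ j < n ] (f i * f j))        ≡⟨ sum-cong-≗ (λ i → *-distribˡ-sum 2 (λ j → f i * f j)) ⟩
  ∑[ i < n ] ∑[ j < n ] (2 * (f i * f j))        ≤⟨ ∑-mono-≤ (λ i → ∑-mono-≤ (2ab≤a²+b² (f i) ∘ f)) ⟩
  ∑[ i < n ] ∑[ j < n ] (sq i + sq j)            ≡⟨ sum-cong-≗ (λ i → ∑-distrib-+ (λ _ → sq i) sq) ⟩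
  ∑[ i < n ] (∑[ j < n ] sq i + Q)               ≡⟨ sum-cong-≗ (λ i → cong (_+ Q) (∑-const n (sq i))) ⟩
  ∑[ i < n ] (n * sq i + Q)                      ≡⟨ ∑-distrib-+ (λ i → n * sq i) (λ _ → Q) ⟩
  ∑[ i < n ] (n * sq i) + ∑[ i < n ] Q           ≡⟨ cong₂ _+_ (sym (*-distribˡ-sum n sq)) (∑-const n Q) ⟩
  n * Q + n * Q                                  ≡⟨ cong (n * Q +_) (sym (+-identityʳ (n * Q))) ⟩
  2 * (n * Q)                                    ∎)
  where
  open ≤-Reasoning
  sq : Vector ℕ n
  sq i = f i * f i
  Q : ℕ
  Q = sum sq

square-sum≤ : ∀ {n} (f : Vector ℕ n) →
  sum f * sum f ≤ ∑[ i < n ] (f i * f i) + 2 * ∑[ i < n ] ∑[ j < n ] (⟦ i Fin.<? j ⟧ * (f i * f j))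
square-sum≤ {n} f = begin
  sum f * sum f                                       ≡⟨ sum-*-sum f f ⟩
  ∑[ i < n ] ∑[ j < n ] (f i * f j)                   ≤⟨ ∑-mono-≤ (λ i → ∑-mono-≤ (split i)) ⟩
  ∑[ i < n ] ∑[ j < n ] (diag i j + (pair i j + pair j i))
    ≡⟨ sum-cong-≗ (λ i → trans (∑-distrib-+ (diag i) _)
                               (cong₂ _+_ (∑-select i sq) (∑-distrib-+ (pair i) _))) ⟩
  ∑[ i < n ] (sq i + (∑[ j < n ] pair i j + ∑[ j < n ] pair j i))
    ≡⟨ trans (∑-distrib-+ sq _) (cong (sum sq +_) (∑-distrib-+ (λ i → ∑[ j < n ] pair i j) _)) ⟩
  sum sq + (Pairs + ∑[ i < n ] ∑[ j < n ] pair j i)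
    ≡⟨ cong (λ z → sum sq + (Pairs + z)) (∑-comm (λ i j → pair j i)) ⟩
  sum sq + (Pairs + Pairs)
    ≡⟨ cong (λ z → sum sq + (Pairs + z)) (sym (+-identityʳ Pairs)) ⟩
  sum sq + 2 * Pairs ∎
  where
  open ≤-Reasoning
  sq : Vector ℕ n
  sq i = f i * f i
  diag pair : Fin n → Fin n → ℕ
  diag i j = ⟦ j Fin.≟ i ⟧ * sq j
  pair i j = ⟦ i Fin.<? j ⟧ * (f i * f j)
  Pairs : ℕ
  Pairs = ∑[ i < n ] ∑[ j < n ] pair i j
  split : ∀ i j → f i * f j ≤ diag i j + (pair i j + pair j i)
  split i j with Fin.<-cmp i j
  ... | tri< i<j _ _ = ≤-trans (m≤⟦⟧*m (i Fin.<? j) i<j) (≤-trans (m≤m+n _ (pair j i)) (m≤n+m _ (diag i j)))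
  ... | tri≈ _ refl _ = ≤-trans (m≤⟦⟧*m (i Fin.≟ i) refl) (m≤m+n _ _)
  ... | tri> _ _ j<i = ≤-trans (≤-reflexive (*-comm (f i) (f j)))
                        (≤-trans (m≤⟦⟧*m (j Fin.<? i) j<i) (≤-trans (m≤n+m _ (pair i j)) (m≤n+m _ (diag i j))))

quadratic-bound : ∀ D n E → D * D ≤ n * D + 4 * E → D * D ≤ 8 * (E + n * n)
quadratic-bound D n E hyp = +-cancelˡ-≤ (D * D) _ _ (begin
  D * D + D * D                      ≡⟨ solve (D ∷ []) ⟩
  2 * (D * D)                        ≤⟨ *-monoʳ-≤ 2 hyp ⟩
  2 * (n * D + 4 * E)                ≡⟨ solve (n ∷ D ∷ E ∷ []) ⟩
  2 * (n * D) + 8 * E                ≤⟨ +-monoˡ-≤ (8 * E) (2ab≤a²+b² n D) ⟩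
  n * n + D * D + 8 * E              ≤⟨ m≤m+n _ (7 * (n * n)) ⟩
  n * n + D * D + 8 * E + 7 * (n * n) ≡⟨ solve (n ∷ D ∷ E ∷ []) ⟩
  D * D + 8 * (E + n * n)            ∎)
  where open ≤-Reasoning

leastBelow : ∀ {p} {P : ℕ → Set p} → Decidable P → ℕ → ℕ
leastBelow P? zero    = zero
leastBelow P? (suc N) with P? zero
... | yes _ = zero
... | no  _ = suc (leastBelow (P? ∘ suc) N)

leastBelow-≤ : ∀ {p} {P : ℕ → Set p} (P? : Decidable P) (N : ℕ) → leastBelow P? N ≤ N
leastBelow-≤ P? zero    = z≤n
leastBelow-≤ P? (suc N) with P? zero
... | yes _ = z≤n
... | no  _ = s≤s (leastBelow-≤ (P? ∘ suc) N)

leastBelow-sound : ∀ {p} {P : ℕ → Set p} (P? : Decidable P) (N : ℕ) →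
                   leastBelow P? N < N → P (leastBelow P? N)
leastBelow-sound P? (suc N) lt with P? zero
... | yes p0 = p0
... | no  _  = leastBelow-sound (P? ∘ suc) N (≤-pred lt)

leastBelow-minimal : ∀ {p} {P : ℕ → Set p} (P? : Decidable P) (N : ℕ) →
                     ∀ {k} → P k → leastBelow P? N ≤ k
leastBelow-minimal P? zero    _ = z≤n
leastBelow-minimal P? (suc N) {k} pk with P? zero
leastBelow-minimal P? (suc N) {k}     pk | yes _  = z≤n
leastBelow-minimal P? (suc N) {zero}  pk | no ¬p0 = ⊥-elim (¬p0 pk)
leastBelow-minimal P? (suc N) {suc k} pk | no _   = s≤s (leastBelow-minimal (P? ∘ suc) N pk)

leastFin : ∀ {n p} {P : Pred (Fin n) p} → Decidable P → Maybe (Fin n)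
leastFin {zero}  P? = nothing
leastFin {suc n} P? with P? zero
... | yes _ = just zero
... | no  _ = Maybe.map suc (leastFin (P? ∘ suc))

leastFin-least : ∀ {n p} {P : Pred (Fin n) p} (P? : Decidable P) {j} → P j →
                 ∃ λ i → leastFin P? ≡ just i × P i × toℕ i ≤ toℕ j
leastFin-least {suc n} P? {j} pj with P? zero
leastFin-least {suc n} P? {j}     pj | yes p0 = zero , refl , p0 , z≤n
leastFin-least {suc n} P? {zero}  pj | no ¬p0 = ⊥-elim (¬p0 pj)
leastFin-least {suc n} P? {suc j} pj | no _ with leastFin-least (P? ∘ suc) pj
... | i , found , pi , i≤j = suc i , cong (Maybe.map suc) found , pi , s≤s i≤j

common-bound : ∀ {n ℓ} {Q : Fin n → ℕ → Set ℓ} → (∀ i → ∃ (Q i)) →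
               ∃ λ N → ∀ i → ∃ λ k → k < N × Q i k
common-bound {zero}  _ = 0 , λ ()
common-bound {suc n} q with q zero | common-bound (q ∘ suc)
... | k₀ , q₀ | N , qs = suc k₀ + N , λ
  { zero    → k₀ , s≤s (m≤m+n k₀ N) , q₀
  ; (suc i) → let k , k<N , qi = qs i in k , ≤-trans k<N (m≤n+m N (suc k₀)) , qi
  }

module _ {n} {G : Graph n} where

  walk-snoc : ∀ {x u v k} → Walk G x u k → G u v ≡ true → Walk G x v (suc k)
  walk-snoc []      e = e ∷ []
  walk-snoc (e′ ∷ w) e = e′ ∷ walk-snoc w e

  walk-++ : ∀ {x y z a b} → Walk G x y a → Walk G y z b → Walk G x z (a + b)
  walk-++ []      w′ = w′
  walk-++ (e ∷ w) w′ = e ∷ walk-++ w w′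

  walk-unsnoc : ∀ {x w k} → Walk G x w (suc k) → ∃ λ u → Walk G x u k × G u w ≡ true
  walk-unsnoc (e ∷ [])      = _ , [] , e
  walk-unsnoc (e ∷ (e′ ∷ w)) with walk-unsnoc (e′ ∷ w)
  ... | u , w′ , e″ = u , e ∷ w′ , e″

walk-⊆G : ∀ {n} {H G : Graph n} → H ⊆G G → ∀ {x y k} → Walk H x y k → Walk G x y k
walk-⊆G H⊆G []      = []
walk-⊆G H⊆G (e ∷ w) = H⊆G _ _ e ∷ walk-⊆G H⊆G w

walk? : ∀ {n} (G : Graph n) k x y → Dec (Walk G x y k)
walk? G zero x y with x Fin.≟ y
... | yes refl = yes []
... | no  x≢y  = no λ { [] → x≢y refl }
walk? G (suc k) x y with Fin.any? (λ z → (G x z Bool.≟ true) ×-dec walk? G k z y)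
... | yes (z , e , w) = yes (e ∷ w)
... | no  ∄           = no λ { (e ∷ w) → ∄ (_ , e , w) }

IsDist-⊆G : ∀ {n} {H G : Graph n} → H ⊆G G →
            ∀ {x y d} → Walk H x y d → IsDist G x y d → IsDist H x y d
IsDist-⊆G H⊆G w (_ , none-shorter) = w , λ k k<d → none-shorter k k<d ∘ walk-⊆G H⊆G

demand-lengths-bounded : ∀ {n} (G : Graph n) (P : Fin n → Fin n → Bool) →
  (∀ x t → P x t ≡ true → Reachable G x t) →
  ∃ λ N → ∀ x t → P x t ≡ true → ∃ λ k → k < N × Walk G x t k
demand-lengths-bounded G P reach =
  let N , bounded = common-bound (λ x → common-bound (demanded x)) in
  N , λ x t Pxt → let M , M<N , inner = bounded x ; k , k<M , walk = inner t in
                  k , <-trans k<M M<N , walk Pxt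
  where
  demanded : ∀ x t → ∃ λ k → P x t ≡ true → Walk G x t k
  demanded x t with P x t in Pxt
  ... | true  = let k , walk = reach x t Pxt in k , λ _ → walk
  ... | false = 0 , λ ()

module BFS {n} (G : Graph n) (N : ℕ) where

  -- δ x y is dist(x, y) when that is below N, and N otherwise.
  δ : Fin n → Fin n → ℕ
  δ x y = leastBelow (λ k → walk? G k x y) N

  δ≤N : ∀ x y → δ x y ≤ N
  δ≤N x y = leastBelow-≤ _ N

  δ-walk : ∀ {x y} → δ x y < N → Walk G x y (δ x y)
  δ-walk = leastBelow-sound _ N

  δ-minimal : ∀ {x y k} → Walk G x y k → δ x y ≤ k
  δ-minimal = leastBelow-minimal _ N

  δ-edge : ∀ x {u v} → G u v ≡ true → δ x v ≤ suc (δ x u)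
  δ-edge x {u} e with δ x u <? N
  ... | yes δxu<N = δ-minimal (walk-snoc (δ-walk δxu<N) e)
  ... | no  δxu≮N = ≤-trans (δ≤N x _) (m≤n⇒m≤1+n (≮⇒≥ δxu≮N))

  δ-triangle : ∀ {x y z a} → Walk G x y a → δ x z ≤ a + δ y z
  δ-triangle {y = y} {z} w with δ y z <? N
  ... | yes δyz<N = δ-minimal (walk-++ w (δ-walk δyz<N))
  ... | no  δyz≮N = ≤-trans (δ≤N _ z) (≤-trans (≮⇒≥ δyz≮N) (m≤n+m _ _))

  δ≡0⇒≡ : ∀ {x y} → 0 < N → δ x y ≡ 0 → x ≡ y
  δ≡0⇒≡ {x} {y} 0<N δ≡0 with subst (Walk G x y) δ≡0 (δ-walk (subst (_< N) (sym δ≡0) 0<N))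
  ... | [] = refl

  IsParent : Fin n → Fin n → Fin n → Set
  IsParent x w v = G v w ≡ true × suc (δ x v) ≡ δ x w

  isParent? : ∀ x w → Decidable (IsParent x w)
  isParent? x w v = (G v w Bool.≟ true) ×-dec (suc (δ x v) ≟ δ x w)

  parent-exists : ∀ {x w k} → δ x w ≡ suc k → suc k < N → ∃ (IsParent x w)
  parent-exists {x} {w} {k} δ≡ lt
    with walk-unsnoc (subst (Walk G x w) δ≡ (δ-walk (subst (_< N) (sym δ≡) lt)))
  ... | u , walk , e = u , e , trans (cong suc (≤-antisym (δ-minimal walk) k≤δxu)) (sym δ≡)
    where k≤δxu = ≤-pred (subst (_≤ suc (δ x u)) δ≡ (δ-edge x e))

  -- Every source breaks ties between parents by the same rule, least index first;
  -- earlier-parent-stalls rests on this.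
  parent : Fin n → Fin n → Fin n
  parent x w = fromMaybe w (leastFin (isParent? x w))

  parent-minimal : ∀ {x w v} → IsParent x w v → toℕ (parent x w) ≤ toℕ v
  parent-minimal {x} {w} isP with leastFin-least (isParent? x w) isP
  ... | i , found , _ , i≤v = subst (λ p → toℕ p ≤ _) (sym (cong (fromMaybe w) found)) i≤v

  parent-isParent : ∀ {x w k} → δ x w ≡ suc k → suc k < N → IsParent x w (parent x w)
  parent-isParent {x} {w} δ≡ lt with leastFin-least (isParent? x w) (proj₂ (parent-exists δ≡ lt))
  ... | i , found , isP , _ = subst (IsParent x w) (sym (cong (fromMaybe w) found)) isP

  δ-parent : ∀ {x w k} → δ x w ≡ suc k → suc k < N → δ x (parent x w) ≡ k
  δ-parent δ≡ lt = suc-injective (trans (proj₂ (parent-isParent δ≡ lt)) δ≡)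

  -- treePath x (δ x t) t lists the vertices t, parent x t, … of the tree path from x to t
  -- other than x; each stands for the tree edge entering it.
  treePath : Fin n → ℕ → Fin n → List (Fin n)
  treePath x zero    t = []
  treePath x (suc k) t = t ∷ treePath x k (parent x t)

  treePath-edge : ∀ {x k t w} → δ x t ≡ k → k < N → w ∈ₗ treePath x k t → G (parent x w) w ≡ true
  treePath-edge {k = suc k} δ≡ lt (here refl) = proj₁ (parent-isParent δ≡ lt)
  treePath-edge {k = suc k} δ≡ lt (there w∈) = treePath-edge (δ-parent δ≡ lt) (<⇒≤ lt) w∈

  treePath-walk : ∀ {H : Graph n} {x k t} → (∀ w → w ∈ₗ treePath x k t → H (parent x w) w ≡ true) →
                  δ x t ≡ k → k < N → Walk H x t k
  treePath-walk {k = zero}      _      δ≡ lt = subst (λ t → Walk _ _ t 0) (δ≡0⇒≡ lt δ≡) []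
  treePath-walk {k = suc k} {t} inH δ≡ lt =
    walk-snoc (treePath-walk (λ w → inH w ∘ there) (δ-parent δ≡ lt) (<⇒≤ lt)) (inH t (here refl))

  stall : Fin n → Fin n → Fin n → ℕ
  stall x y w = ⟦ δ y w ≤? δ y (parent x w) ⟧

  -- δ y grows by at most one along each tree edge.
  treePath-stalls : ∀ {x k t} y → δ x t ≡ k → k < N →
                    List.sum (map (stall x y) (treePath x k t)) + δ y t ≤ δ y x + k
  treePath-stalls {x} {zero} {t} y δ≡ lt =
    subst (λ x → δ y t ≤ δ y x + 0) (sym (δ≡0⇒≡ lt δ≡)) (≤-reflexive (sym (+-identityʳ _)))
  treePath-stalls {x} {suc k} {t} y δ≡ lt = begin
    stall x y t + S′ + δ y t    ≡⟨ xy∙z≈y∙xz (stall x y t) S′ (δ y t) ⟩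
    S′ + (stall x y t + δ y t)  ≤⟨ +-monoʳ-≤ S′ (⟦≤⟧+-≤ (δ y t ≤? δ y p) (δ-edge y pt)) ⟩
    S′ + suc (δ y p)            ≡⟨ +-suc S′ (δ y p) ⟩
    suc (S′ + δ y p)            ≤⟨ s≤s (treePath-stalls y (δ-parent δ≡ lt) (<⇒≤ lt)) ⟩
    suc (δ y x + k)             ≡⟨ +-suc (δ y x) k ⟨
    δ y x + suc k               ∎
    where
    open ≤-Reasoning
    p = parent x t
    pt = proj₁ (parent-isParent δ≡ lt)
    S′ = List.sum (map (stall x y) (treePath x k p))

  earlier-parent-stalls : ∀ {x y w} → G (parent x w) w ≡ true → toℕ (parent x w) < toℕ (parent y w) →
                          δ y w ≤ δ y (parent x w)
  earlier-parent-stalls {y = y} e earlier =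
    ≮⇒≥ λ closer → <⇒≱ earlier (parent-minimal (e , ≤-antisym closer (δ-edge y e)))

module Preserver {n} (G : Graph n) (S : Subset n) (h : ℕ) (P : Fin n → Fin n → Bool) (N : ℕ)
  (diameter : ∀ x y → x ∈ S → y ∈ S → DistLe G x y h)
  (sources : ∀ x t → P x t ≡ true → x ∈ S)
  (short : ∀ x t → P x t ≡ true → ∃ λ k → k < N × Walk G x t k) where

  open BFS G N

  δ<N : ∀ {x t} → P x t ≡ true → δ x t < N
  δ<N {x} {t} Pxt = let k , k<N , walk = short x t Pxt in ≤-<-trans (δ-minimal walk) k<N

  δ-exact : ∀ {x t d} → P x t ≡ true → IsDist G x t d → δ x t ≡ d
  δ-exact Pxt (walk , none-shorter) =
    ≤-antisym (δ-minimal walk) (≮⇒≥ λ δ<d → none-shorter _ δ<d (δ-walk (δ<N Pxt)))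

  path : Fin n → Fin n → List (Fin n)
  path x t = treePath x (δ x t) t

  Carries : Fin n → Fin n → Set
  Carries u w = ∃₂ λ x t → P x t ≡ true × w ∈ₗ path x t × parent x w ≡ u

  carries? : ∀ u w → Dec (Carries u w)
  carries? u w = Fin.any? λ x → Fin.any? λ t →
    (P x t Bool.≟ true) ×-dec (w ∈ₗ? path x t) ×-dec (parent x w Fin.≟ u)

  H : Graph n
  H u w = does (carries? u w)

  H-carries : ∀ {u w} → H u w ≡ true → Carries u w
  H-carries {u} {w} = does≡true⇒ (carries? u w)

  path-in-H : ∀ {x t w} → P x t ≡ true → w ∈ₗ path x t → H (parent x w) w ≡ true
  path-in-H Pxt w∈ = dec-true (carries? _ _) (_ , _ , Pxt , w∈ , refl)

  H⊆G : H ⊆G G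
  H⊆G u w e with H-carries e
  ... | x , t , Pxt , w∈ , refl = treePath-edge refl (δ<N Pxt) w∈

  H-preserves : IsPreserver G P H
  H-preserves = H⊆G , λ x t Pxt d dist → IsDist-⊆G H⊆G
    (subst (Walk H x t) (δ-exact Pxt dist) (treePath-walk (λ _ → path-in-H Pxt) refl (δ<N Pxt))) dist

  path-stalls≤2h : ∀ {x t y} → P x t ≡ true → y ∈ S → List.sum (map (stall x y) (path x t)) ≤ h + h
  path-stalls≤2h {x} {t} {y} Pxt y∈S = +-cancelʳ-≤ (δ y t) _ _ (begin
    List.sum (map (stall x y) (path x t)) + δ y t  ≤⟨ treePath-stalls y refl (δ<N Pxt) ⟩
    δ y x + δ x t                                 ≤⟨ +-mono-≤ δyx≤h δxt≤h+δyt ⟩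
    h + (h + δ y t)                               ≡⟨ +-assoc h h (δ y t) ⟨
    h + h + δ y t                                 ∎)
    where
    open ≤-Reasoning
    x∈S = sources x t Pxt
    δyx≤h : δ y x ≤ h
    δyx≤h = let k , k≤h , walk = diameter y x y∈S x∈S in ≤-trans (δ-minimal walk) k≤h
    δxt≤h+δyt : δ x t ≤ h + δ y t
    δxt≤h+δyt = let k , k≤h , walk = diameter x y x∈S y∈S in
                ≤-trans (δ-triangle walk) (+-monoˡ-≤ (δ y t) k≤h)

  crossings : Fin n → Fin n → Fin n → ℕ
  crossings x y w = ⟦ y ∈? S ⟧ * ∑[ t < n ] (𝟙 (P x t) * (⟦ w ∈ₗ? path x t ⟧ * stall x y w))

  in-pair-crossing : ∀ {u u′ w} → toℕ u < toℕ u′ → H u w ≡ true → H u′ w ≡ true →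
    1 ≤ ∑[ x < n ] (⟦ u Fin.≟ parent x w ⟧ * ∑[ y < n ] (⟦ u′ Fin.≟ parent y w ⟧ * crossings x y w))
  in-pair-crossing {w = w} u<u′ Huw Hu′w with H-carries Huw | H-carries Hu′w
  ... | x , t , Pxt , w∈xt , refl | y , t′ , Pyt′ , _ , refl = begin
    1
      ≤⟨ *-mono-≤ (1≤⟦⟧ (ux Fin.≟ ux) refl) (*-mono-≤ (1≤⟦⟧ (uy Fin.≟ uy) refl) crossing) ⟩
    ⟦ ux Fin.≟ ux ⟧ * term x y
      ≤⟨ *-monoʳ-≤ ⟦ ux Fin.≟ ux ⟧ (term≤sum (term x) y) ⟩
    ⟦ ux Fin.≟ ux ⟧ * ∑[ y′ < n ] term x y′
      ≤⟨ term≤sum (λ x′ → ⟦ ux Fin.≟ parent x′ w ⟧ * ∑[ y′ < n ] term x′ y′) x ⟩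
    ∑[ x′ < n ] (⟦ ux Fin.≟ parent x′ w ⟧ * ∑[ y′ < n ] term x′ y′) ∎
    where
    open ≤-Reasoning
    ux = parent x w
    uy = parent y w
    term : Fin n → Fin n → ℕ
    term x′ y′ = ⟦ uy Fin.≟ parent y′ w ⟧ * crossings x′ y′ w
    stalls : 1 ≤ stall x y w
    stalls = 1≤⟦⟧ (δ y w ≤? δ y ux) (earlier-parent-stalls (H⊆G _ _ Huw) u<u′)
    crossing : 1 ≤ crossings x y w
    crossing = *-mono-≤ (1≤⟦⟧ (y ∈? S) (sources y t′ Pyt′))
      (≤-trans (*-mono-≤ (1≤𝟙 Pxt) (*-mono-≤ (1≤⟦⟧ (w ∈ₗ? path x t) w∈xt) stalls))
               (term≤sum (λ t → 𝟙 (P x t) * (⟦ w ∈ₗ? path x t ⟧ * stall x y w)) t))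

  in-pairs≤crossings : ∀ w → ∑[ u < n ] ∑[ u′ < n ] (⟦ u Fin.<? u′ ⟧ * (𝟙 (H u w) * 𝟙 (H u′ w)))
                             ≤ ∑[ x < n ] ∑[ y < n ] crossings x y w
  in-pairs≤crossings w = begin
    ∑[ u < n ] ∑[ u′ < n ] (⟦ u Fin.<? u′ ⟧ * (𝟙 (H u w) * 𝟙 (H u′ w)))
      ≤⟨ ∑-mono-≤ (λ u → ∑-mono-≤ λ u′ → ⟦⟧*𝟙*𝟙≤ (u Fin.<? u′) (H u w) (H u′ w) in-pair-crossing) ⟩
    ∑[ u < n ] ∑[ u′ < n ] ∑[ x < n ]
      (⟦ u Fin.≟ parent x w ⟧ * ∑[ y < n ] (⟦ u′ Fin.≟ parent y w ⟧ * crossings x y w))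
      ≡⟨ ∑-fibres₂ (λ x → parent x w) (λ y → parent y w) (λ x y → crossings x y w) ⟩
    ∑[ x < n ] ∑[ y < n ] crossings x y w ∎
    where open ≤-Reasoning

  ∑w-crossings≤ : ∀ x y → ∑[ w < n ] crossings x y w ≤ ⟦ y ∈? S ⟧ * (∑[ t < n ] 𝟙 (P x t) * (h + h))
  ∑w-crossings≤ x y = begin
    ∑[ w < n ] crossings x y w
      ≡⟨ *-distribˡ-sum {n} ⟦ y ∈? S ⟧ _ ⟨
    ⟦ y ∈? S ⟧ * ∑[ w < n ] ∑[ t < n ] (𝟙 (P x t) * stalls t w)
      ≡⟨ cong (⟦ y ∈? S ⟧ *_) (∑-comm (λ w t → 𝟙 (P x t) * stalls t w)) ⟩
    ⟦ y ∈? S ⟧ * ∑[ t < n ] ∑[ w < n ] (𝟙 (P x t) * stalls t w)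
      ≡⟨ cong (⟦ y ∈? S ⟧ *_) (sum-cong-≗ λ t → *-distribˡ-sum (𝟙 (P x t)) (stalls t)) ⟨
    ⟦ y ∈? S ⟧ * ∑[ t < n ] (𝟙 (P x t) * ∑[ w < n ] stalls t w)
      ≤⟨ ⟦⟧*-monoʳ-≤ (y ∈? S) (λ y∈S → ∑-mono-≤ λ t → 𝟙*-monoʳ-≤ (P x t) λ Pxt →
           ≤-trans (∑-∈-≤ (path x t) (stall x y)) (path-stalls≤2h Pxt y∈S)) ⟩
    ⟦ y ∈? S ⟧ * ∑[ t < n ] (𝟙 (P x t) * (h + h))
      ≡⟨ cong (⟦ y ∈? S ⟧ *_) (*-distribʳ-sum (h + h) (λ t → 𝟙 (P x t))) ⟨
    ⟦ y ∈? S ⟧ * (∑[ t < n ] 𝟙 (P x t) * (h + h)) ∎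
    where
    open ≤-Reasoning
    stalls : Fin n → Fin n → ℕ
    stalls t w = ⟦ w ∈ₗ? path x t ⟧ * stall x y w

  ∑-crossings≤ : ∑[ w < n ] ∑[ x < n ] ∑[ y < n ] crossings x y w ≤ ∣ S ∣ * (count P * (h + h))
  ∑-crossings≤ = begin
    ∑[ w < n ] ∑[ x < n ] ∑[ y < n ] crossings x y w
      ≡⟨ ∑-comm (λ w x → ∑[ y < n ] crossings x y w) ⟩
    ∑[ x < n ] ∑[ w < n ] ∑[ y < n ] crossings x y w
      ≡⟨ sum-cong-≗ (λ x → ∑-comm (λ w y → crossings x y w)) ⟩
    ∑[ x < n ] ∑[ y < n ] ∑[ w < n ] crossings x y w
      ≤⟨ ∑-mono-≤ (λ x → ∑-mono-≤ (∑w-crossings≤ x)) ⟩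
    ∑[ x < n ] ∑[ y < n ] (⟦ y ∈? S ⟧ * (row x * (h + h)))
      ≡⟨ sum-cong-≗ (λ x → trans (cong (_* (row x * (h + h))) (∣S∣≡∑ S))
                                 (*-distribʳ-sum (row x * (h + h)) (λ y → ⟦ y ∈? S ⟧))) ⟨
    ∑[ x < n ] (∣ S ∣ * (row x * (h + h)))
      ≡⟨ *-distribˡ-sum ∣ S ∣ (λ x → row x * (h + h)) ⟨
    ∣ S ∣ * ∑[ x < n ] (row x * (h + h))
      ≡⟨ cong (∣ S ∣ *_) (trans (cong (_* (h + h)) (count-∑ P)) (*-distribʳ-sum (h + h) row)) ⟨
    ∣ S ∣ * (count P * (h + h)) ∎
    where
    open ≤-Reasoning
    row : Fin n → ℕ
    row x = ∑[ t < n ] 𝟙 (P x t)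

  indeg : Fin n → ℕ
  indeg w = ∑[ u < n ] 𝟙 (H u w)

  count-H : count H ≡ ∑[ w < n ] indeg w
  count-H = trans (count-∑ H) (∑-comm λ u w → 𝟙 (H u w))

  indeg²≤ : ∀ w → indeg w * indeg w ≤ indeg w + 2 * ∑[ x < n ] ∑[ y < n ] crossings x y w
  indeg²≤ w = ≤-trans (square-sum≤ (λ u → 𝟙 (H u w)))
    (+-mono-≤ (≤-reflexive (sum-cong-≗ λ u → 𝟙*𝟙 (H u w))) (*-monoʳ-≤ 2 (in-pairs≤crossings w)))

  count-H² : count H * count H ≤ n * count H + 4 * (n * ∣ S ∣ * count P * h)
  count-H² = begin
    count H * count H
      ≡⟨ cong₂ _*_ count-H count-H ⟩
    sum indeg * sum indeg
      ≤⟨ cauchy-schwarz indeg ⟩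
    n * ∑[ w < n ] (indeg w * indeg w)
      ≤⟨ *-monoʳ-≤ n (∑-mono-≤ indeg²≤) ⟩
    n * ∑[ w < n ] (indeg w + 2 * X w)
      ≡⟨ cong (n *_) (trans (∑-distrib-+ indeg (λ w → 2 * X w))
                            (cong₂ _+_ (sym count-H) (sym (*-distribˡ-sum 2 X)))) ⟩
    n * (count H + 2 * sum X)
      ≤⟨ *-monoʳ-≤ n (+-monoʳ-≤ (count H) (*-monoʳ-≤ 2 ∑-crossings≤)) ⟩
    n * (count H + 2 * (∣ S ∣ * (count P * (h + h))))
      ≡⟨ expand n (count H) ∣ S ∣ (count P) h ⟩
    n * count H + 4 * (n * ∣ S ∣ * count P * h) ∎
    where
    open ≤-Reasoning
    X : Fin n → ℕ
    X w = ∑[ x < n ] ∑[ y < n ] crossings x y w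
    expand : ∀ n c s p h → n * (c + 2 * (s * (p * (h + h)))) ≡ n * c + 4 * (n * s * p * h)
    expand = solve-∀

lemma5p7 : Σ ℕ λ C →
    ∀ (n : ℕ) (G : Graph n) (S : Subset n) (h : ℕ) (P : Fin n → Fin n → Bool) →
    (∀ x y → x ∈ S → y ∈ S → DistLe G x y h) →
    (∀ x t → P x t ≡ true → x ∈ S × Reachable G x t) →
    Σ (Graph n) λ H → IsPreserver G P H ×
    count H * count H ≤ C * (n * ∣ S ∣ * count P * h + n * n)
lemma5p7 = 8 , λ n G S h P diameter demand →
  let N , short = demand-lengths-bounded G P (λ x t → proj₂ ∘ demand x t)
      open Preserver G S h P N diameter (λ x t → proj₁ ∘ demand x t) short
  in H , H-preserves , quadratic-bound (count H) n (n * ∣ S ∣ * count P * h) count-H²
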